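{- Let $G$ be a graph on $n$ vertices and let $t\ge 1$ be an integer such that all but $t$ vertices of $G$ have degree $n-1$. Then $\mathrm{cp}(G)<tn$.
   Context: A clique partition of a graph $G$ is a collection of complete subgraphs of $G$ whose edge sets partition $E(G)$; $\mathrm{cp}(G)$ is the minimum number of cliques in a clique partition of $G$. -}

module Defs where

open import Data.Nat using (ℕ; _∸_; _≡ᵇ_)
open import Data.Fin using (Fin)
open import Data.Bool using (Bool; true; false; not)
open import Data.List using (List; length; filterᵇ; allFin)
open import Data.Product using (Σ; _×_)
open import Relation.Binary.PropositionalEquality using (_≡_; _≢_)
open import Data.Fin.Subset using (Subset; _∈_)

record Graph (n : ℕ) : Set where
  field
    adj    : Fin n → Fin n → Bool
    sym    : ∀ u v → adj u v ≡ adj v u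
    irrefl : ∀ v → adj v v ≡ false
open Graph public

degree : ∀ {n} → Graph n → Fin n → ℕ
degree {n} G v = length (filterᵇ (adj G v) (allFin n))

numNonFull : ∀ {n} → Graph n → ℕ
numNonFull {n} G = length (filterᵇ (λ v → not (degree G v ≡ᵇ (n ∸ 1))) (allFin n))

IsClique : ∀ {n} → Graph n → Subset n → Set
IsClique G S = ∀ u v → u ∈ S → v ∈ S → u ≢ v → adj G u v ≡ true

IsCliquePartition : ∀ {n k} → Graph n → (Fin k → Subset n) → Set
IsCliquePartition {n} {k} G C =
  (∀ i → IsClique G (C i)) ×
  (∀ u v → adj G u v ≡ true →
     Σ (Fin k) λ i → (u ∈ C i × v ∈ C i) ×
       (∀ j → u ∈ C j → v ∈ C j → j ≡ i))

-- "cp G ≤ k": G has a clique partition with (at most) k cliques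
-- (edgeless cliques, e.g. empty ones, are allowed, so padding shows this
--  is exactly cp G ≤ k)
HasCliquePartitionOfSize : ∀ {n} → Graph n → ℕ → Set
HasCliquePartitionOfSize {n} G k = Σ (Fin k → Subset n) λ C → IsCliquePartition G C

module Submission where

-- Call a vertex full if its degree is n - 1, i.e. it is adjacent to every
-- other vertex; let v₀, …, v₍t₋₁₎ enumerate the non-full vertices.  The full
-- vertices form one clique.  Every other edge has a non-full endpoint, and
-- we let one of them own the edge: the non-full endpoint if the other one is
-- full, the smaller one otherwise.  Each vᵢ receives n - 1 slots, one for
-- every potential partner w ≠ vᵢ; slot (i, w) holds {vᵢ, w} if vᵢ owns the
-- edge vᵢw and is empty otherwise.  These 1 + t(n - 1) cliques partition
-- E(G).  Finally t ≥ 1 forces t ≥ 2, since a non-full vertex has a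
-- non-neighbour, which is then non-full as well; hence 1 + t(n - 1) < tn.

open import Defs
open import Data.Nat using (ℕ; _*_; _<_; _≤_)
open import Data.Product using (Σ; _×_)
open import Relation.Binary.PropositionalEquality using (_≡_)

open import Data.Nat using (zero; suc; s≤s; z≤n; _≡ᵇ_; _+_; _≟_)
import Data.Nat.Properties as ℕ
open import Data.Bool using (Bool; true; false; not; T)
open import Data.Fin as Fin using (Fin; punchIn; punchOut; combine; remQuot)
import Data.Fin.Properties as Fin
open import Data.Fin.Subset using (Subset; _∈_)
open import Data.List using (List; _∷_; length; filter; filterᵇ; allFin; lookup)
open import Data.List.Properties using (filter-accept; filter-reject; filter-all; filter-notAll; length-tabulate)
open import Data.List.Membership.Propositional using () renaming (_∈_ to _∈ₗ_)
open import Data.List.Membership.Propositional.Properties using (∈-allFin; ∈-lookup; ∈-filter⁺; ∈-filter⁻)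
open import Data.List.Relation.Unary.Any as Any using (here; there)
open import Data.List.Relation.Unary.Any.Properties using (lookup-index)
import Data.List.Relation.Unary.All as All
open import Data.List.Relation.Unary.AllPairs using (_∷_)
open import Data.List.Relation.Unary.Unique.Propositional using (Unique)
import Data.List.Relation.Unary.Unique.Propositional.Properties as Unique
open import Data.Vec using (tabulate)
import Data.Vec.Properties as Vec
open import Data.Product using (_,_; proj₁; proj₂; ∃)
open import Data.Sum using (_⊎_; inj₁; inj₂)
open import Data.Empty using (⊥; ⊥-elim)
open import Data.Unit using (tt)
open import Function using (_∘_)
open import Relation.Nullary using (¬_; Dec; yes; no; does; ¬?)
open import Relation.Nullary.Decidable using (T?; _×-dec_; _⊎-dec_; decidable-stable; dec-true)
open import Relation.Unary using (Decidable)
open import Relation.Binary using (tri<; tri≈; tri>)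
open import Relation.Binary.PropositionalEquality
  using (_≢_; refl; trans; cong; subst; subst₂) renaming (sym to ≡-sym)

-- A degree is the length of a
-- filtered list, so these two lemmas translate "u has two distinct
-- non-neighbours" and "u is its own only non-neighbour" into degrees.
module _ {A : Set} {P : A → Set} (P? : Decidable P) where

  filter-reject-two : ∀ {x y} xs → x ≢ y → x ∈ₗ xs → y ∈ₗ xs → ¬ P x → ¬ P y →
                      2 + length (filter P? xs) ≤ length xs
  filter-reject-two (z ∷ zs) x≢y (here refl) (here refl) _ _ = ⊥-elim (x≢y refl)
  filter-reject-two (z ∷ zs) _ (here refl) (there y∈zs) ¬Px ¬Py
    rewrite filter-reject P? {xs = zs} ¬Px =
      s≤s (filter-notAll P? zs (Any.map (λ { refl → ¬Py }) y∈zs))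
  filter-reject-two (z ∷ zs) _ (there x∈zs) (here refl) ¬Px ¬Py
    rewrite filter-reject P? {xs = zs} ¬Py =
      s≤s (filter-notAll P? zs (Any.map (λ { refl → ¬Px }) x∈zs))
  filter-reject-two (z ∷ zs) x≢y (there x∈zs) (there y∈zs) ¬Px ¬Py
    with filter-reject-two zs x≢y x∈zs y∈zs ¬Px ¬Py | P? z
  ... | shorter | yes _ = s≤s shorter
  ... | shorter | no _  = ℕ.m≤n⇒m≤1+n shorter

  filter-reject-one : ∀ {x} xs → Unique xs → x ∈ₗ xs → ¬ P x →
                      (∀ {y} → y ∈ₗ xs → y ≢ x → P y) →
                      1 + length (filter P? xs) ≡ length xs
  filter-reject-one (z ∷ zs) (z∉zs ∷ _) (here refl) ¬Px others
    rewrite filter-reject P? {xs = zs} ¬Px =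
      cong (suc ∘ length) (filter-all P? (All.tabulate λ y∈zs →
        others (there y∈zs) (λ { refl → All.lookup z∉zs y∈zs refl })))
  filter-reject-one (z ∷ zs) (z∉zs ∷ unique) (there x∈zs) ¬Px others
    rewrite filter-accept P? {xs = zs} (others (here refl) (All.lookup z∉zs x∈zs)) =
      cong suc (filter-reject-one zs unique x∈zs ¬Px (others ∘ there))

lookup-injective : ∀ {A : Set} {xs : List A} → Unique xs →
                   ∀ i j → lookup xs i ≡ lookup xs j → i ≡ j
lookup-injective {xs = _ ∷ _} _ Fin.zero Fin.zero _ = refl
lookup-injective {xs = _ ∷ _} (x∉ ∷ _) Fin.zero (Fin.suc j) eq =
  ⊥-elim (All.lookup x∉ (∈-lookup j) eq)
lookup-injective {xs = _ ∷ _} (x∉ ∷ _) (Fin.suc i) Fin.zero eq =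
  ⊥-elim (All.lookup x∉ (∈-lookup i) (≡-sym eq))
lookup-injective {xs = _ ∷ _} (_ ∷ unique) (Fin.suc i) (Fin.suc j) eq =
  cong Fin.suc (lookup-injective unique i j eq)

distinct⇒2≤ : ∀ {t} (i j : Fin t) → i ≢ j → 2 ≤ t
distinct⇒2≤ {1} Fin.zero Fin.zero i≢j = ⊥-elim (i≢j refl)
distinct⇒2≤ {suc (suc _)} _ _ _ = s≤s (s≤s z≤n)

≢⇒T-not-≡ᵇ : ∀ {m n} → m ≢ n → T (not (m ≡ᵇ n))
≢⇒T-not-≡ᵇ {m} {n} m≢n with m ≡ᵇ n in eq
... | false = tt
... | true  = m≢n (ℕ.≡ᵇ⇒≡ m n (subst T (≡-sym eq) tt))

T-not-≡ᵇ⇒≢ : ∀ {m n} → T (not (m ≡ᵇ n)) → m ≢ n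
T-not-≡ᵇ⇒≢ {m} different refl with m ≡ᵇ m | ℕ.≡⇒≡ᵇ m m refl
... | true  | _ = different
... | false | ()

⟦_⟧ : ∀ {n} {P : Fin n → Set} → Decidable P → Subset n
⟦ P? ⟧ = tabulate (does ∘ P?)

∈⟦⟧⁺ : ∀ {n} {P : Fin n → Set} (P? : Decidable P) {x} → P x → x ∈ ⟦ P? ⟧
∈⟦⟧⁺ P? {x} Px = Vec.lookup⇒[]= x _ (trans (Vec.lookup∘tabulate _ x) (dec-true (P? x) Px))

∈⟦⟧⁻ : ∀ {n} {P : Fin n → Set} (P? : Decidable P) {x} → x ∈ ⟦ P? ⟧ → P x
∈⟦⟧⁻ P? {x} x∈ with P? x | trans (≡-sym (Vec.lookup∘tabulate (does ∘ P?) x)) (Vec.[]=⇒lookup x∈)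
... | yes Px | _ = Px
... | no _   | ()

module Degrees {m : ℕ} (G : Graph (suc m)) where

  Vertex : Set
  Vertex = Fin (suc m)

  Adj : Vertex → Vertex → Set
  Adj u v = T (adj G u v)

  Adj⇒≡true : ∀ {u v} → Adj u v → adj G u v ≡ true
  Adj⇒≡true {u} {v} uv with adj G u v
  ... | true = refl

  ≡true⇒Adj : ∀ {u v} → adj G u v ≡ true → Adj u v
  ≡true⇒Adj e = subst T (≡-sym e) tt

  Adj-sym : ∀ {u v} → Adj u v → Adj v u
  Adj-sym {u} {v} = subst T (sym G u v)

  Adj-irrefl : ∀ v → ¬ Adj v v
  Adj-irrefl v = subst T (irrefl G v)

  Full : Vertex → Set
  Full v = degree G v ≡ m

  Full? : Decidable Full
  Full? v = degree G v ≟ m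

  length-allFin : length (allFin (suc m)) ≡ suc m
  length-allFin = length-tabulate (λ v → v)

  -- u misses itself in its neighbourhood; missing a second vertex v
  -- leaves it with degree at most n - 2.
  nonNeighbour⇒nonFull : ∀ {u v} → u ≢ v → ¬ Adj u v → ¬ Full u
  nonNeighbour⇒nonFull {u} {v} u≢v ¬uv full =
    ℕ.1+n≰n (subst₂ (λ d l → 2 + d ≤ l) full length-allFin
      (filter-reject-two (T? ∘ adj G u) (allFin (suc m)) u≢v
        (∈-allFin u) (∈-allFin v) (Adj-irrefl u) ¬uv))

  full-adjacent : ∀ {u v} → Full u → u ≢ v → Adj u v
  full-adjacent full u≢v =
    decidable-stable (T? _) (λ ¬uv → nonNeighbour⇒nonFull u≢v ¬uv full)

  -- If u were adjacent to every other vertex, its degree would be m.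
  nonFull⇒nonNeighbour : ∀ {u} → ¬ Full u → ∃ λ v → u ≢ v × ¬ Adj u v
  nonFull⇒nonNeighbour {u} ¬full =
    decidable-stable (Fin.any? λ v → ¬? (u Fin.≟ v) ×-dec ¬? (T? (adj G u v)))
      λ none → ¬full (ℕ.suc-injective (trans (degree+1 none) length-allFin))
    where
    degree+1 : ¬ (∃ λ v → u ≢ v × ¬ Adj u v) → 1 + degree G u ≡ length (allFin (suc m))
    degree+1 none =
      filter-reject-one (T? ∘ adj G u) (allFin (suc m)) (Unique.allFin⁺ (suc m))
        (∈-allFin u) (Adj-irrefl u)
        (λ {v} _ v≢u → decidable-stable (T? _)
          (λ ¬uv → none (v , (λ u≡v → v≢u (≡-sym u≡v)) , ¬uv)))

module NonFullVertices {m : ℕ} (G : Graph (suc m)) where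
  open Degrees G

  isNonFull : Vertex → Bool
  isNonFull v = not (degree G v ≡ᵇ m)

  nonFullList : List Vertex
  nonFullList = filterᵇ isNonFull (allFin (suc m))

  t : ℕ
  t = length nonFullList

  vertex : Fin t → Vertex
  vertex = lookup nonFullList

  vertex-nonFull : ∀ i → ¬ Full (vertex i)
  vertex-nonFull i = T-not-≡ᵇ⇒≢ (proj₂ (∈-filter⁻ (T? ∘ isNonFull) {xs = allFin (suc m)} (∈-lookup {xs = nonFullList} i)))

  vertex-onto : ∀ {v} → ¬ Full v → ∃ λ i → vertex i ≡ v
  vertex-onto {v} ¬full = Any.index v∈ , ≡-sym (lookup-index v∈)
    where
    v∈ : v ∈ₗ nonFullList
    v∈ = ∈-filter⁺ (T? ∘ isNonFull) (∈-allFin v) (≢⇒T-not-≡ᵇ ¬full)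

  vertex-injective : ∀ {i j} → vertex i ≡ vertex j → i ≡ j
  vertex-injective = lookup-injective (Unique.filter⁺ (T? ∘ isNonFull) (Unique.allFin⁺ (suc m))) _ _

  -- A non-full vertex u has a non-neighbour v ≠ u, and v is non-full too.
  at-least-two : 1 ≤ t → 2 ≤ t
  at-least-two 1≤t =
    let i = Fin.fromℕ< 1≤t
        (v , u≢v , ¬uv) = nonFull⇒nonNeighbour (vertex-nonFull i)
        (j , vj≡v) = vertex-onto (nonNeighbour⇒nonFull (u≢v ∘ ≡-sym) (¬uv ∘ Adj-sym))
    in distinct⇒2≤ i j (λ i≡j → u≢v (trans (cong vertex i≡j) vj≡v))

module Construction {m : ℕ} (G : Graph (suc m)) where
  open Degrees G
  open NonFullVertices G

  -- Slot (i, o) belongs to the non-full vertex i and stands for its o-th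
  -- potential partner, i.e. the o-th vertex other than vertex i.
  Slot : Set
  Slot = Fin t × Fin m

  owner : Slot → Vertex
  owner (i , _) = vertex i

  partner : Slot → Vertex
  partner (i , o) = punchIn (vertex i) o

  slot-determined : ∀ p q → owner p ≡ owner q → partner p ≡ partner q → p ≡ q
  slot-determined (i , o) (j , o′) same-owner same-partner with vertex-injective same-owner
  ... | refl = cong (i ,_) (Fin.punchIn-injective (vertex i) o o′ same-partner)

  -- c owns the edge cd if d is full or c < d; for a non-full c this picks
  -- exactly one owner among the non-full endpoints of each edge.
  Owns : Vertex → Vertex → Set
  Owns c d = Adj c d × (Full d ⊎ c Fin.< d)

  Owns? : ∀ c d → Dec (Owns c d)
  Owns? c d = T? (adj G c d) ×-dec (Full? d ⊎-dec c Fin.<? d)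

  owns-nonFull⇒< : ∀ {c d} → ¬ Full d → Owns c d → c Fin.< d
  owns-nonFull⇒< ¬full (_ , inj₁ full) = ⊥-elim (¬full full)
  owns-nonFull⇒< _     (_ , inj₂ c<d)  = c<d

  InSlot : Slot → Vertex → Set
  InSlot p x = Owns (owner p) (partner p) × (x ≡ owner p ⊎ x ≡ partner p)

  InSlot? : ∀ p → Decidable (InSlot p)
  InSlot? p x = Owns? (owner p) (partner p) ×-dec (x Fin.≟ owner p ⊎-dec x Fin.≟ partner p)

  slot-members : ∀ {p a b} → a ≢ b → InSlot p a → InSlot p b →
                 (a ≡ owner p × b ≡ partner p) ⊎ (a ≡ partner p × b ≡ owner p)
  slot-members a≢b (_ , inj₁ refl) (_ , inj₁ refl) = ⊥-elim (a≢b refl)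
  slot-members a≢b (_ , inj₁ a≡o) (_ , inj₂ b≡q) = inj₁ (a≡o , b≡q)
  slot-members a≢b (_ , inj₂ a≡q) (_ , inj₁ b≡o) = inj₂ (a≡q , b≡o)
  slot-members a≢b (_ , inj₂ refl) (_ , inj₂ refl) = ⊥-elim (a≢b refl)

  -- Clique 0 holds the full vertices, clique 1 + (i·m + o) the slot (i, o).
  size : ℕ
  size = suc (t * m)

  clique : Fin size → Subset (suc m)
  clique Fin.zero    = ⟦ Full? ⟧
  clique (Fin.suc x) = ⟦ InSlot? (remQuot m x) ⟧

  slotIndex : Slot → Fin size
  slotIndex (i , o) = Fin.suc (combine i o)

  slotIndex-remQuot : ∀ x → slotIndex (remQuot {t} m x) ≡ Fin.suc x
  slotIndex-remQuot x = cong Fin.suc (Fin.combine-remQuot {t} m x)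

  ∈slotIndex : ∀ {p x} → InSlot p x → x ∈ clique (slotIndex p)
  ∈slotIndex {i , o} x∈p =
    subst (λ q → _ ∈ ⟦ InSlot? q ⟧) (≡-sym (Fin.remQuot-combine i o)) (∈⟦⟧⁺ (InSlot? _) x∈p)

  isClique : ∀ j → IsClique G (clique j)
  isClique Fin.zero a b a∈ _ a≢b = Adj⇒≡true (full-adjacent (∈⟦⟧⁻ Full? a∈) a≢b)
  isClique (Fin.suc x) a b a∈ b∈ a≢b
    with ∈⟦⟧⁻ (InSlot? _) a∈ | slot-members a≢b (∈⟦⟧⁻ (InSlot? _) a∈) (∈⟦⟧⁻ (InSlot? _) b∈)
  ... | (owns , _) | inj₁ (refl , refl) = Adj⇒≡true (proj₁ owns)
  ... | (owns , _) | inj₂ (refl , refl) = Adj⇒≡true (Adj-sym (proj₁ owns))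

  CoveredOnce : Vertex → Vertex → Set
  CoveredOnce a b = Σ (Fin size) λ j → (a ∈ clique j × b ∈ clique j) ×
                      (∀ j′ → a ∈ clique j′ → b ∈ clique j′ → j′ ≡ j)

  coveredOnce-sym : ∀ {a b} → CoveredOnce a b → CoveredOnce b a
  coveredOnce-sym (j , (a∈ , b∈) , unique) = j , (b∈ , a∈) , λ j′ b∈′ a∈′ → unique j′ a∈′ b∈′

  -- An edge between full vertices lies only in clique 0: every slot
  -- contains its non-full owner.
  full-edge : ∀ {a b} → Full a → Full b → a ≢ b → CoveredOnce a b
  full-edge {a} {b} fa fb a≢b = Fin.zero , (∈⟦⟧⁺ Full? fa , ∈⟦⟧⁺ Full? fb) , unique
    where
    unique : ∀ j → a ∈ clique j → b ∈ clique j → j ≡ Fin.zero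
    unique Fin.zero _ _ = refl
    unique (Fin.suc x) a∈ b∈ with slot-members a≢b (∈⟦⟧⁻ (InSlot? _) a∈) (∈⟦⟧⁻ (InSlot? _) b∈)
    ... | inj₁ (refl , _) = ⊥-elim (vertex-nonFull _ fa)
    ... | inj₂ (_ , refl) = ⊥-elim (vertex-nonFull _ fb)

  -- No slot holds an edge cd owned by the non-full c with d as its owner:
  -- both would be non-full, and ownership would force c < d < c.
  not-reversed : ∀ q {c d} → ¬ Full c → Owns c d → c ≡ partner q → d ≡ owner q → InSlot q c → ⊥
  not-reversed (i , _) ¬fc owns refl refl (owns′ , _) =
    Fin.<-asym (owns-nonFull⇒< (vertex-nonFull i) owns) (owns-nonFull⇒< ¬fc owns′)

  owned-edge : ∀ {c d} → ¬ Full c → c ≢ d → Owns c d → CoveredOnce c d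
  owned-edge {c} {d} ¬fc c≢d owns with vertex-onto ¬fc
  ... | i , refl = slotIndex p , (∈slotIndex c∈p , ∈slotIndex d∈p) , unique
    where
    p : Slot
    p = i , punchOut c≢d

    partner≡d : partner p ≡ d
    partner≡d = Fin.punchIn-punchOut c≢d

    c∈p : InSlot p c
    c∈p = subst (Owns c) (≡-sym partner≡d) owns , inj₁ refl

    d∈p : InSlot p d
    d∈p = proj₁ c∈p , inj₂ (≡-sym partner≡d)

    unique : ∀ j → c ∈ clique j → d ∈ clique j → j ≡ slotIndex p
    unique Fin.zero c∈ _ = ⊥-elim (¬fc (∈⟦⟧⁻ Full? c∈))
    unique (Fin.suc x) c∈ d∈
      with ∈⟦⟧⁻ (InSlot? _) c∈ | slot-members c≢d (∈⟦⟧⁻ (InSlot? _) c∈) (∈⟦⟧⁻ (InSlot? _) d∈)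
    ... | _ | inj₁ (c≡owner , d≡partner) =
      trans (≡-sym (slotIndex-remQuot x))
        (cong slotIndex (slot-determined _ p (≡-sym c≡owner) (trans (≡-sym d≡partner) (≡-sym partner≡d))))
    ... | c∈q | inj₂ (c≡partner , d≡owner) = ⊥-elim (not-reversed _ ¬fc owns c≡partner d≡owner c∈q)

  cover : ∀ {a b} → adj G a b ≡ true → CoveredOnce a b
  cover {a} {b} e with Full? a | Full? b
  ... | yes fa | yes fb = full-edge fa fb a≢b
    where a≢b = λ { refl → Adj-irrefl a (≡true⇒Adj e) }
  ... | no ¬fa | yes fb = owned-edge ¬fa a≢b (≡true⇒Adj e , inj₁ fb)
    where a≢b = λ { refl → ¬fa fb }
  ... | yes fa | no ¬fb = coveredOnce-sym (owned-edge ¬fb b≢a (Adj-sym (≡true⇒Adj e) , inj₁ fa))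
    where b≢a = λ { refl → ¬fb fa }
  ... | no ¬fa | no ¬fb with Fin.<-cmp a b
  ...   | tri< a<b a≢b _ = owned-edge ¬fa a≢b (≡true⇒Adj e , inj₂ a<b)
  ...   | tri≈ _ refl _  = ⊥-elim (Adj-irrefl a (≡true⇒Adj e))
  ...   | tri> _ a≢b b<a =
    coveredOnce-sym (owned-edge ¬fb (a≢b ∘ ≡-sym) (Adj-sym (≡true⇒Adj e) , inj₂ b<a))

  isCliquePartition : IsCliquePartition G clique
  isCliquePartition = isClique , λ _ _ → cover

fewer-than-tn : ∀ t m → 2 ≤ t → suc (t * m) < t * suc m
fewer-than-tn t m 2≤t rewrite ℕ.*-suc t m = ℕ.+-monoˡ-≤ (t * m) 2≤t

lemma6p5 : (n : ℕ) (G : Graph n) (t : ℕ) → 1 ≤ t → numNonFull G ≡ t →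
    Σ ℕ λ k → (k < t * n) × HasCliquePartitionOfSize G k
lemma6p5 zero    G .(numNonFull G) () refl
lemma6p5 (suc m) G .(numNonFull G) 1≤t refl =
  size , fewer-than-tn t m (at-least-two 1≤t) , clique , isCliquePartition
  where
  open NonFullVertices G
  open Construction G
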